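{- If $\mathrm{LDL}_{\mathrm{poly}}\ne\mathrm{LDL}$, then $\overline{\mathrm{HNN}}\ne\overline{\mathrm{NN}}$.
   Context: All classes are classes of families of Boolean functions $f_n:\{0,1\}^n\to\{0,1\}$; "polynomial" means polynomial in $n$. A linear decision list (LDL) is a sequence of instructions "if $f_i(\mathbf{x})=1$ then output $c_i$" ($i=1,\dots,m$) followed by "output 0", where each $f_i$ is a threshold gate $\mathbf{1}[\langle\mathbf{w}_i,\mathbf{x}\rangle\ge\theta_i]$ and $c_i\in\{0,1\}$; length $m$, maximum weight the largest coefficient of any $f_i$. $\mathrm{LDL}$: polynomial length; $\mathrm{LDL}_{\mathrm{poly}}$: polynomial length and polynomially bounded maximum weight. Let $\Delta(\mathbf{x},\mathbf{y})=\|\mathbf{x}-\mathbf{y}\|_2^2$. An NN representation of $f$ is a pair of disjoint finite sets $P,N\subseteq\mathbb{R}^n$ such that $f(\mathbf{x})=1$ if some $\mathbf{p}\in P$ has $\Delta(\mathbf{x},\mathbf{p})<\Delta(\mathbf{x},\mathbf{q})$ for all $\mathbf{q}\in N$, and $f(\mathbf{x})=0$ if some $\mathbf{q}\in N$ has $\Delta(\mathbf{x},\mathbf{q})<\Delta(\mathbf{x},\mathbf{p})$ for all $\mathbf{p}\in P$; an HNN representation additionally has $P,N\subseteq\{0,1\}^n$. $\mathrm{NN}$, $\mathrm{HNN}$ are the classes with such representations with polynomially many anchors. A substitution of variables $v:\{0,1\}^n\to\{0,1\}^{\tilde n}$ outputs a vector each of whose coordinates is some $x_i$ (duplication allowed)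 or a constant; $f$ is a subfunction of $g$ if $\tilde n=\mathrm{poly}(n)$ and $f=g\circ v$ for some substitution $v$. $\overline{C}$ denotes the set of subfunctions of members of $C$. -}

module Defs where

open import Data.Bool using (Bool; true; false; if_then_else_)
open import Data.Nat as ℕ using (ℕ; suc; _^_)
open import Data.Integer as ℤ using (ℤ; ∣_∣)
open import Data.Rational as ℚ using (ℚ; 0ℚ; 1ℚ)
open import Data.Fin using (Fin)
open import Data.Vec using (Vec; []; _∷_; map; lookup; foldr; zipWith)
open import Data.List using (List; length)
open import Data.List.Membership.Propositional using (_∈_; _∉_)
open import Data.List.Relation.Unary.All using (All)
open import Data.Sum using (_⊎_; inj₁; inj₂)
open import Data.Product using (Σ; ∃; ∃-syntax; _×_; _,_)
open import Relation.Binary.PropositionalEquality using (_≡_)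
open import Relation.Nullary using (¬_)

Family : Set
Family = (n : ℕ) → Vec Bool n → Bool

Class : Set₁
Class = Family → Set

_≐_ : Class → Class → Set
C ≐ D = (F : Family) → (C F → D F) × (D F → C F)

polyBound : ℕ → ℕ → ℕ
polyBound k n = k ℕ.* (suc n ^ k)

bℤ : Bool → ℤ
bℤ true  = ℤ.+ 1
bℤ false = ℤ.+ 0

inner : ∀ {n} → Vec ℤ n → Vec Bool n → ℤ
inner w x = foldr _ ℤ._+_ (ℤ.+ 0) (zipWith (λ a b → a ℤ.* bℤ b) w x)

record Gate (n : ℕ) : Set where
  constructor gate
  field
    weights : Vec ℤ n
    thresh  : ℤ

gateEval : ∀ {n} → Gate n → Vec Bool n → Bool
gateEval (gate w θ) x with θ ℤ.≤? inner w x
... | Relation.Nullary.yes _ = true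
... | Relation.Nullary.no  _ = false

LDList : ℕ → Set
LDList n = List (Gate n × Bool)

ldlEval : ∀ {n} → LDList n → Vec Bool n → Bool
ldlEval List.[] x = false
ldlEval ((g , c) List.∷ L) x = if gateEval g x then c else ldlEval L x

GateWeightsBounded : ∀ {n} → ℕ → Gate n → Set
GateWeightsBounded W (gate w θ) = Data.Vec.Relation.Unary.All.All (λ a → ∣ a ∣ ℕ.≤ W) w
  where import Data.Vec.Relation.Unary.All

MaxWeightBounded : ∀ {n} → ℕ → LDList n → Set
MaxWeightBounded W L = All (λ gc → GateWeightsBounded W (Data.Product.proj₁ gc)) L

Computes : ∀ {n} → LDList n → (Vec Bool n → Bool) → Set
Computes L f = ∀ x → ldlEval L x ≡ f x

LDL : Class
LDL F = ∃[ k ] ∀ n → ∃[ L ] (length L ℕ.≤ polyBound k n × Computes L (F n))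

LDLpoly : Class
LDLpoly F = ∃[ k ] ∀ n → ∃[ L ]
  (length L ℕ.≤ polyBound k n × MaxWeightBounded (polyBound k n) L × Computes L (F n))

bℚ : Bool → ℚ
bℚ true  = 1ℚ
bℚ false = 0ℚ

Δ : ∀ {n} → Vec Bool n → Vec ℚ n → ℚ
Δ x p = foldr _ ℚ._+_ 0ℚ (zipWith (λ a b → (bℚ a ℚ.- b) ℚ.* (bℚ a ℚ.- b)) x p)

NNRep : ∀ {n} → List (Vec ℚ n) → List (Vec ℚ n) → (Vec Bool n → Bool) → Set
NNRep P N f =
  (∀ p → p ∈ P → p ∉ N) ×
  (∀ x → (f x ≡ true  → ∃[ p ] (p ∈ P × All (λ q → Δ x p ℚ.< Δ x q) N))
       × (f x ≡ false → ∃[ q ] (q ∈ N × All (λ p → Δ x q ℚ.< Δ x p) P)))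

NN : Class
NN F = ∃[ k ] ∀ n → ∃[ P ] ∃[ N ]
  (length P ℕ.+ length N ℕ.≤ polyBound k n × NNRep P N (F n))

embed : ∀ {n} → Vec Bool n → Vec ℚ n
embed = map bℚ

HNN : Class
HNN F = ∃[ k ] ∀ n → ∃[ P ] ∃[ N ]
  (length P ℕ.+ length N ℕ.≤ polyBound k n
   × NNRep (Data.List.map embed P) (Data.List.map embed N) (F n))

Substitution : ℕ → ℕ → Set
Substitution n m = Vec (Fin n ⊎ Bool) m

applySubst : ∀ {n m} → Substitution n m → Vec Bool n → Vec Bool m
applySubst σ x = map (λ { (inj₁ i) → lookup x i ; (inj₂ b) → b }) σ

closure : Class → Class
closure C F = ∃[ G ] (C G × ∃[ k ] ∀ n → ∃[ m ] (m ℕ.≤ polyBound k n ×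
  ∃[ σ ] (∀ (x : Vec Bool n) → F n x ≡ G m (applySubst {n} {m} σ x))))

-- The HNN side and the LDL side meet through Hamming balls. With Boolean anchors the squared
-- distance is the Hamming distance, and "x lies in the ball of radius r around a" is the threshold
-- gate <±a, x> ≥ |a| - r with weights ±1. Scanning the radii r = 0, 1, …, n and, for each r, all
-- anchors, the first ball that contains x is centred at a nearest anchor, so an HNN representation
-- is an LDL with weights ±1; substituting variables keeps the weights polynomial. Hence
-- closure(HNN) ⊆ LDL_poly.
--
-- Conversely, an LDL with L instructions is the label of the largest of L + 1 affine forms whose
-- scales grow geometrically along the list (the form of the first firing gate outweighs all later
-- ones, a non-firing gate gets a negative value). Put the coefficient vectors v₁ … v_N of the forms
-- into anchors (l_j, v_j, v₁, …, v_{j-1}, 0, v_{j+1}, …, v_N), l_j the label bit: all anchors have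
-- the same squared norm up to l_j, so at the point (0, 1, x, 0, …, 0) the distance to anchor j is
-- a constant plus l_j minus twice the value of form j. This gives an NN representation, in
-- dimension polynomial in n, of a function of which F_n is a subfunction, so LDL ⊆ closure(NN).
-- Distances to anchors of opposite labels differ in parity, which rules out ties everywhere.
--
-- If closure(HNN) = closure(NN), then LDL ⊆ closure(NN) = closure(HNN) ⊆ LDL_poly.

module Submission where

open import Defs
open import Data.Bool using (Bool; true; false; not; _xor_; if_then_else_)
import Data.Bool
open import Data.Bool.Properties using (¬-not; not-¬)
open import Data.Empty using (⊥-elim)
open import Data.Fin using (Fin; zero; suc)
open import Data.Integer as ℤ using (ℤ; +_)
import Data.Integer.Properties as ℤP
open import Data.Integer.Solver using (module +-*-Solver)
open import Data.List as L using (List; []; _∷_; _++_; length)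
import Data.List.Properties as LP
open import Data.List.Membership.Propositional using (_∈_; find; lose)
open import Data.List.Membership.Propositional.Properties
open import Data.List.Relation.Unary.All as All using (All; []; _∷_)
import Data.List.Relation.Unary.All.Properties as AllP
open import Data.List.Relation.Unary.Any as Any using (Any; here; there)
open import Data.Maybe using (Maybe; just; nothing)
open import Data.Nat as ℕ using (ℕ; suc; zero)
open import Data.Nat.Coprimality using (1-coprimeTo; sym)
import Data.Nat.Properties as ℕP
open import Data.Product using (∃-syntax; _×_; _,_; proj₁; proj₂)
open import Data.Rational as ℚ using (ℚ; mkℚ)
import Data.Rational.Properties as ℚP
import Data.Rational.Unnormalised as ℚᵘ
import Data.Rational.Unnormalised.Properties as ℚᵘP
open import Data.Sum using (_⊎_; inj₁; inj₂)
open import Data.Vec as V using (Vec; []; _∷_)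
import Data.Vec.Properties as VP
import Data.Vec.Relation.Unary.All as VAll
open import Function.Base using (case_of_; _∘_)
open import Function.Bundles using (_⇔_; mk⇔; Equivalence)
open import Relation.Binary.Bundles using (DecTotalOrder)
open import Relation.Binary.Definitions using (tri<; tri≈; tri>)
open import Relation.Binary.PropositionalEquality hiding (sym)
import Relation.Binary.PropositionalEquality as Eq
open import Relation.Nullary using (¬_; Dec; does; yes; no)
open import Relation.Nullary.Decidable using (dec-true; dec-false)

open import Data.List.Extrema (DecTotalOrder.totalOrder ℚP.≤-decTotalOrder) using (argmin; argmin-all; f[argmin]≤f[xs])
open +-*-Solver

fromℤ : ℤ → ℚ
fromℤ z = mkℚ z 0 (sym (1-coprimeTo _))

fromℤ-+ : ∀ i j → fromℤ (i ℤ.+ j) ≡ fromℤ i ℚ.+ fromℤ j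
fromℤ-+ i j = ℚP.toℚᵘ-injective
  (ℚᵘP.≃-trans (ℚᵘ.*≡* (cong (ℤ._* + 1) (Eq.sym (cong₂ ℤ._+_ (ℤP.*-identityʳ i) (ℤP.*-identityʳ j)))))
               (ℚᵘP.≃-sym (ℚP.toℚᵘ-homo-+ (fromℤ i) (fromℤ j))))

fromℤ-* : ∀ i j → fromℤ (i ℤ.* j) ≡ fromℤ i ℚ.* fromℤ j
fromℤ-* i j = ℚP.toℚᵘ-injective (ℚᵘP.≃-trans (ℚᵘ.*≡* refl) (ℚᵘP.≃-sym (ℚP.toℚᵘ-homo-* (fromℤ i) (fromℤ j))))

fromℤ-neg : ∀ i → fromℤ (ℤ.- i) ≡ ℚ.- fromℤ i
fromℤ-neg i = ℚP.toℚᵘ-injective (ℚᵘP.≃-trans (ℚᵘ.*≡* refl) (ℚᵘP.≃-sym (ℚP.toℚᵘ-homo‿- (fromℤ i))))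

fromℤ-- : ∀ i j → fromℤ (i ℤ.- j) ≡ fromℤ i ℚ.- fromℤ j
fromℤ-- i j = trans (fromℤ-+ i (ℤ.- j)) (cong (fromℤ i ℚ.+_) (fromℤ-neg j))

fromℤ-mono-< : ∀ {i j} → i ℤ.< j → fromℤ i ℚ.< fromℤ j
fromℤ-mono-< {i} {j} i<j = ℚ.*<* (subst₂ ℤ._<_ (Eq.sym (ℤP.*-identityʳ i)) (Eq.sym (ℤP.*-identityʳ j)) i<j)

fromℤ-cancel-< : ∀ {i j} → fromℤ i ℚ.< fromℤ j → i ℤ.< j
fromℤ-cancel-< {i} {j} (ℚ.*<* i<j) = subst₂ ℤ._<_ (ℤP.*-identityʳ i) (ℤP.*-identityʳ j) i<j

fromℤ-injective : ∀ {i j} → fromℤ i ≡ fromℤ j → i ≡ j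
fromℤ-injective refl = refl

ones : ∀ {n} → Vec Bool n → ℤ
ones [] = + 0
ones (b ∷ y) = bℤ b ℤ.+ ones y

normSq : ∀ {n} → Vec ℤ n → ℤ
normSq [] = + 0
normSq (c ∷ a) = c ℤ.* c ℤ.+ normSq a

bℚ≡fromℤ∘bℤ : ∀ b → bℚ b ≡ fromℤ (bℤ b)
bℚ≡fromℤ∘bℤ true = refl
bℚ≡fromℤ∘bℤ false = refl

square-sub : ∀ b c → (bℤ b ℤ.- c) ℤ.* (bℤ b ℤ.- c) ≡ bℤ b ℤ.+ c ℤ.* c ℤ.- + 2 ℤ.* (c ℤ.* bℤ b)
square-sub true = solve 1 (λ c → (con (+ 1) :- c) :* (con (+ 1) :- c) := con (+ 1) :+ c :* c :- con (+ 2) :* (c :* con (+ 1))) refl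
square-sub false = solve 1 (λ c → (con (+ 0) :- c) :* (con (+ 0) :- c) := con (+ 0) :+ c :* c :- con (+ 2) :* (c :* con (+ 0))) refl

Δ-fromℤ : ∀ {n} (y : Vec Bool n) (a : Vec ℤ n) →
  Δ y (V.map fromℤ a) ≡ fromℤ (ones y ℤ.+ normSq a ℤ.- + 2 ℤ.* inner a y)
Δ-fromℤ [] [] = refl
Δ-fromℤ (b ∷ y) (c ∷ a) = begin
  (bℚ b ℚ.- fromℤ c) ℚ.* (bℚ b ℚ.- fromℤ c) ℚ.+ Δ y (V.map fromℤ a)
    ≡⟨ cong₂ (λ u v → (u ℚ.- fromℤ c) ℚ.* (u ℚ.- fromℤ c) ℚ.+ v) (bℚ≡fromℤ∘bℤ b) (Δ-fromℤ y a) ⟩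
  (fromℤ B ℚ.- fromℤ c) ℚ.* (fromℤ B ℚ.- fromℤ c) ℚ.+ fromℤ R
    ≡⟨ cong (λ u → u ℚ.* u ℚ.+ fromℤ R) (Eq.sym (fromℤ-- B c)) ⟩
  fromℤ (B ℤ.- c) ℚ.* fromℤ (B ℤ.- c) ℚ.+ fromℤ R
    ≡⟨ cong (ℚ._+ fromℤ R) (Eq.sym (fromℤ-* (B ℤ.- c) (B ℤ.- c))) ⟩
  fromℤ ((B ℤ.- c) ℤ.* (B ℤ.- c)) ℚ.+ fromℤ R
    ≡⟨ Eq.sym (fromℤ-+ ((B ℤ.- c) ℤ.* (B ℤ.- c)) R) ⟩
  fromℤ ((B ℤ.- c) ℤ.* (B ℤ.- c) ℤ.+ R)
    ≡⟨ cong (λ u → fromℤ (u ℤ.+ R)) (square-sub b c) ⟩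
  fromℤ (B ℤ.+ c ℤ.* c ℤ.- + 2 ℤ.* (c ℤ.* B) ℤ.+ R)
    ≡⟨ cong fromℤ (solve 6 (λ B c K O S I → B :+ c :* c :- con (+ 2) :* K :+ (O :+ S :- con (+ 2) :* I)
                              := (B :+ O) :+ (c :* c :+ S) :- con (+ 2) :* (K :+ I))
                       refl B c (c ℤ.* B) (ones y) (normSq a) (inner a y)) ⟩
  fromℤ (ones (b ∷ y) ℤ.+ normSq (c ∷ a) ℤ.- + 2 ℤ.* inner (c ∷ a) (b ∷ y)) ∎
  where
  open ≡-Reasoning
  B : ℤ
  B = bℤ b
  R : ℤ
  R = ones y ℤ.+ normSq a ℤ.- + 2 ℤ.* inner a y

hamming : ∀ {n} → Vec Bool n → Vec Bool n → ℕ
hamming [] [] = 0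
hamming (b ∷ y) (c ∷ a) = (if b xor c then 1 else 0) ℕ.+ hamming y a

hamming≤length : ∀ {n} (y a : Vec Bool n) → hamming y a ℕ.≤ n
hamming≤length [] [] = ℕ.z≤n
hamming≤length (b ∷ y) (c ∷ a) = ℕP.+-mono-≤ (differs≤1 (b xor c)) (hamming≤length y a)
  where
  differs≤1 : ∀ d → (if d then 1 else 0) ℕ.≤ 1
  differs≤1 true = ℕP.≤-refl
  differs≤1 false = ℕ.z≤n

Δ-embed : ∀ {n} (y a : Vec Bool n) → Δ y (embed a) ≡ fromℤ (+ hamming y a)
Δ-embed [] [] = refl
Δ-embed (b ∷ y) (c ∷ a) = begin
  (bℚ b ℚ.- bℚ c) ℚ.* (bℚ b ℚ.- bℚ c) ℚ.+ Δ y (embed a)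
    ≡⟨ cong₂ ℚ._+_ (square-differs b c) (Δ-embed y a) ⟩
  fromℤ (+ D) ℚ.+ fromℤ (+ hamming y a)
    ≡⟨ Eq.sym (fromℤ-+ (+ D) (+ hamming y a)) ⟩
  fromℤ (+ D ℤ.+ + hamming y a)
    ≡⟨ cong fromℤ (Eq.sym (ℤP.pos-+ D (hamming y a))) ⟩
  fromℤ (+ hamming (b ∷ y) (c ∷ a)) ∎
  where
  open ≡-Reasoning
  D : ℕ
  D = if b xor c then 1 else 0
  square-differs : ∀ b c → (bℚ b ℚ.- bℚ c) ℚ.* (bℚ b ℚ.- bℚ c) ≡ fromℤ (+ (if b xor c then 1 else 0))
  square-differs true true = refl
  square-differs true false = refl
  square-differs false true = refl
  square-differs false false = refl

sign : Bool → ℤ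
sign true = + 1
sign false = ℤ.- + 1

signs : ∀ {n} → Vec Bool n → Vec ℤ n
signs = V.map sign

inner-signs : ∀ {n} (a y : Vec Bool n) → inner (signs a) y ≡ ones a ℤ.- + hamming y a
inner-signs [] [] = refl
inner-signs (c ∷ a) (b ∷ y) = begin
  inner (signs (c ∷ a)) (b ∷ y)
    ≡⟨ cong₂ ℤ._+_ (sign-times c b) (inner-signs a y) ⟩
  (bℤ c ℤ.- + D) ℤ.+ (ones a ℤ.- + hamming y a)
    ≡⟨ solve 4 (λ C D O H → (C :- D) :+ (O :- H) := (C :+ O) :- (D :+ H)) refl (bℤ c) (+ D) (ones a) (+ hamming y a) ⟩
  ones (c ∷ a) ℤ.- (+ D ℤ.+ + hamming y a)
    ≡⟨ cong (λ h → ones (c ∷ a) ℤ.- h) (Eq.sym (ℤP.pos-+ D (hamming y a))) ⟩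
  ones (c ∷ a) ℤ.- + hamming (b ∷ y) (c ∷ a) ∎
  where
  open ≡-Reasoning
  D : ℕ
  D = if b xor c then 1 else 0
  sign-times : ∀ c b → sign c ℤ.* bℤ b ≡ bℤ c ℤ.- + (if b xor c then 1 else 0)
  sign-times true true = refl
  sign-times true false = refl
  sign-times false true = refl
  sign-times false false = refl

gate-fires⇔ : ∀ {n} (w : Vec ℤ n) θ x → (gateEval (gate w θ) x ≡ true) ⇔ (θ ℤ.≤ inner w x)
gate-fires⇔ w θ x with θ ℤ.≤? inner w x
... | yes θ≤ = mk⇔ (λ _ → θ≤) (λ _ → refl)
... | no θ≰ = mk⇔ (λ ()) (λ θ≤ → ⊥-elim (θ≰ θ≤))

gateEval-cong : ∀ {n n′} {w : Vec ℤ n} {w′ : Vec ℤ n′} {θ θ′ x x′} →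
  (θ ℤ.≤ inner w x) ⇔ (θ′ ℤ.≤ inner w′ x′) → gateEval (gate w θ) x ≡ gateEval (gate w′ θ′) x′
gateEval-cong {w = w} {w′} {θ} {θ′} {x} {x′} fires⇔ with θ ℤ.≤? inner w x | θ′ ℤ.≤? inner w′ x′
... | yes _ | yes _ = refl
... | no _ | no _ = refl
... | yes θ≤ | no θ′≰ = ⊥-elim (θ′≰ (Equivalence.to fires⇔ θ≤))
... | no θ≰ | yes θ′≤ = ⊥-elim (θ≰ (Equivalence.from fires⇔ θ′≤))

Fires : ∀ {n} → Vec Bool n → Gate n × Bool → Set
Fires y gc = gateEval (proj₁ gc) y ≡ true

ldlEval-++-uniform : ∀ {n} (y : Vec Bool n) {b} (D R : LDList n) →
  All (λ gc → Fires y gc → proj₂ gc ≡ b) D →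
  ldlEval (D ++ R) y ≡ b ⊎ ldlEval (D ++ R) y ≡ ldlEval R y
ldlEval-++-uniform y [] R [] = inj₂ refl
ldlEval-++-uniform y ((gate w θ , c) ∷ D) R (agrees ∷ agree) with θ ℤ.≤? inner w y
... | yes _ = inj₁ (agrees refl)
... | no _ = ldlEval-++-uniform y D R agree

ldlEval-++-fires : ∀ {n} (y : Vec Bool n) {b} (D R : LDList n) →
  All (λ gc → Fires y gc → proj₂ gc ≡ b) D → Any (Fires y) D → ldlEval (D ++ R) y ≡ b
ldlEval-++-fires y ((gate w θ , c) ∷ D) R (agrees ∷ agree) some with θ ℤ.≤? inner w y
... | yes _ = agrees refl
ldlEval-++-fires y ((gate w θ , c) ∷ D) R (_ ∷ agree) (here fires) | no θ≰ =
  ⊥-elim (θ≰ (Equivalence.to (gate-fires⇔ w θ y) fires))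
ldlEval-++-fires y ((gate w θ , c) ∷ D) R (_ ∷ agree) (there some) | no _ =
  ldlEval-++-fires y D R agree some

MaxWeightBounded-weaken : ∀ {n W W′} (L : LDList n) → W ℕ.≤ W′ → MaxWeightBounded W L → MaxWeightBounded W′ L
MaxWeightBounded-weaken L W≤W′ = All.map λ {(gate w θ , c)} → VAll.map (λ ∣a∣≤W → ℕP.≤-trans ∣a∣≤W W≤W′)

polyBound-monoˡ : ∀ {k k′} n → k ℕ.≤ k′ → polyBound k n ℕ.≤ polyBound k′ n
polyBound-monoˡ n k≤k′ = ℕP.*-mono-≤ k≤k′ (ℕP.^-monoʳ-≤ (suc n) k≤k′)

polyBound-monoʳ : ∀ k {n n′} → n ℕ.≤ n′ → polyBound k n ℕ.≤ polyBound k n′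
polyBound-monoʳ k n≤n′ = ℕP.*-monoʳ-≤ k (ℕP.^-monoˡ-≤ k (ℕ.s≤s n≤n′))

polyBound-suc : ∀ k n → suc n ℕ.* polyBound k n ℕ.≤ polyBound (suc k) n
polyBound-suc k n = begin
  suc n ℕ.* (k ℕ.* suc n ℕ.^ k)   ≡⟨ ℕP.*-comm (suc n) (k ℕ.* suc n ℕ.^ k) ⟩
  k ℕ.* suc n ℕ.^ k ℕ.* suc n     ≡⟨ ℕP.*-assoc k (suc n ℕ.^ k) (suc n) ⟩
  k ℕ.* (suc n ℕ.^ k ℕ.* suc n)   ≡⟨ cong (k ℕ.*_) (ℕP.*-comm (suc n ℕ.^ k) (suc n)) ⟩
  k ℕ.* suc n ℕ.^ suc k           ≤⟨ ℕP.*-monoˡ-≤ (suc n ℕ.^ suc k) (ℕP.n≤1+n k) ⟩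
  polyBound (suc k) n ∎
  where open ℕP.≤-Reasoning

polyBound-suc-positive : ∀ k n → 1 ℕ.≤ polyBound (suc k) n
polyBound-suc-positive k n = ℕP.≤-trans (ℕP.m^n>0 (suc n) (suc k)) (ℕP.m≤m+n _ _)

^-distribʳ-* : ∀ a b p → (a ℕ.* b) ℕ.^ p ≡ a ℕ.^ p ℕ.* b ℕ.^ p
^-distribʳ-* a b zero = refl
^-distribʳ-* a b (suc p) = trans (cong ((a ℕ.* b) ℕ.*_) (^-distribʳ-* a b p)) (*-interchange a b (a ℕ.^ p) (b ℕ.^ p))
  where open import Algebra.Properties.CommutativeSemigroup ℕP.*-commutativeSemigroup
          using () renaming (interchange to *-interchange)

polyBound-∘ : ∀ k k′ {n m} → m ℕ.≤ polyBound k n →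
  polyBound k′ m ℕ.≤ polyBound (k′ ℕ.* suc k ℕ.^ k′ ℕ.+ k ℕ.* k′) n
polyBound-∘ k k′ {n} {m} m≤ = begin
  k′ ℕ.* suc m ℕ.^ k′
    ≤⟨ ℕP.*-monoʳ-≤ k′ (ℕP.^-monoˡ-≤ k′ (ℕP.≤-trans (ℕ.s≤s m≤) (ℕP.+-monoˡ-≤ (k ℕ.* suc n ℕ.^ k) (ℕP.m^n>0 (suc n) k)))) ⟩
  k′ ℕ.* (suc k ℕ.* suc n ℕ.^ k) ℕ.^ k′
    ≡⟨ cong (k′ ℕ.*_) (^-distribʳ-* (suc k) (suc n ℕ.^ k) k′) ⟩
  k′ ℕ.* (suc k ℕ.^ k′ ℕ.* (suc n ℕ.^ k) ℕ.^ k′)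
    ≡⟨ Eq.sym (ℕP.*-assoc k′ _ _) ⟩
  c ℕ.* (suc n ℕ.^ k) ℕ.^ k′
    ≡⟨ cong (c ℕ.*_) (ℕP.^-*-assoc (suc n) k k′) ⟩
  c ℕ.* suc n ℕ.^ (k ℕ.* k′)
    ≤⟨ ℕP.*-mono-≤ (ℕP.m≤m+n c _) (ℕP.^-monoʳ-≤ (suc n) (ℕP.m≤n+m _ c)) ⟩
  polyBound (c ℕ.+ k ℕ.* k′) n ∎
  where
  open ℕP.≤-Reasoning
  c : ℕ
  c = k′ ℕ.* suc k ℕ.^ k′

n≤polyBound1 : ∀ n → n ℕ.≤ polyBound 1 n
n≤polyBound1 n = ℕP.≤-trans (ℕP.n≤1+n n) (ℕP.≤-reflexive (Eq.sym (trans (ℕP.*-identityˡ _) (ℕP.*-identityʳ (suc n)))))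

m+n*a≤[m+n]*a : ∀ m n {a} → 1 ℕ.≤ a → m ℕ.+ n ℕ.* a ℕ.≤ (m ℕ.+ n) ℕ.* a
m+n*a≤[m+n]*a m n {a} 1≤a = subst (m ℕ.+ n ℕ.* a ℕ.≤_) (Eq.sym (ℕP.*-distribʳ-+ a m n))
  (ℕP.+-monoˡ-≤ (n ℕ.* a) (subst (ℕ._≤ m ℕ.* a) (ℕP.*-identityʳ m) (ℕP.*-monoʳ-≤ m 1≤a)))

i-j≤i-k⇔k≤j : ∀ i {j k} → (i ℤ.- j ℤ.≤ i ℤ.- k) ⇔ (k ℤ.≤ j)
i-j≤i-k⇔k≤j i {j} {k} = mk⇔ reflect (λ k≤j → ℤP.+-monoʳ-≤ i (ℤP.neg-mono-≤ k≤j))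
  where
  reflect : i ℤ.- j ℤ.≤ i ℤ.- k → k ℤ.≤ j
  reflect le with k ℤ.≤? j
  ... | yes k≤j = k≤j
  ... | no k≰j = ⊥-elim (ℤP.<-irrefl refl (ℤP.<-≤-trans (ℤP.+-monoʳ-< i (ℤP.neg-mono-< (ℤP.≰⇒> k≰j))) le))

ball : ∀ {n} → Vec Bool n → ℕ → Gate n
ball a r = gate (signs a) (ones a ℤ.- + r)

ball-fires⇔ : ∀ {n} (a y : Vec Bool n) r → (gateEval (ball a r) y ≡ true) ⇔ (hamming y a ℕ.≤ r)
ball-fires⇔ a y r = mk⇔
  (λ fires → ℤP.drop‿+≤+ (Equivalence.to (i-j≤i-k⇔k≤j (ones a))
                            (subst (_ ℤ.≤_) (inner-signs a y) (Equivalence.to (gate-fires⇔ (signs a) _ y) fires))))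
  (λ h≤r → Equivalence.from (gate-fires⇔ (signs a) _ y)
             (subst (_ ℤ.≤_) (Eq.sym (inner-signs a y)) (Equivalence.from (i-j≤i-k⇔k≤j (ones a)) (ℤ.+≤+ h≤r))))

LabelledPoints : ℕ → Set
LabelledPoints n = List (Vec Bool n × Bool)

ballLayer : ∀ {n} → LabelledPoints n → ℕ → LDList n
ballLayer pts r = L.map (λ ac → ball (proj₁ ac) r , proj₂ ac) pts

ballLayers : ∀ {n} → LabelledPoints n → ℕ → ℕ → LDList n
ballLayers pts r zero = []
ballLayers pts r (suc c) = ballLayer pts r ++ ballLayers pts (suc r) c

ballLDL : ∀ {n} → LabelledPoints n → LDList n
ballLDL {n} pts = ballLayers pts 0 (suc n)

module _ {n} (y : Vec Bool n) (pts : LabelledPoints n) {a₀ b} (a₀∈ : (a₀ , b) ∈ pts)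
         (nearest : ∀ {a c} → (a , c) ∈ pts → c ≢ b → hamming y a₀ ℕ.< hamming y a) where

  private
    δ : ℕ
    δ = hamming y a₀

  ballLayer-agrees : ∀ {r} → r ℕ.≤ δ → All (λ gc → Fires y gc → proj₂ gc ≡ b) (ballLayer pts r)
  ballLayer-agrees {r} r≤δ = All.tabulate agrees
    where
    agrees : ∀ {gc} → gc ∈ ballLayer pts r → Fires y gc → proj₂ gc ≡ b
    agrees gc∈ fires with ∈-map⁻ _ gc∈
    ... | (a , c) , ac∈ , refl with c Data.Bool.≟ b
    ...   | yes c≡b = c≡b
    ...   | no c≢b = ⊥-elim (ℕP.<-irrefl refl (ℕP.<-≤-trans (nearest ac∈ c≢b)
                        (ℕP.≤-trans (Equivalence.to (ball-fires⇔ a y r) fires) r≤δ)))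

  ballLayer-fires : Any (Fires y) (ballLayer pts δ)
  ballLayer-fires = Any.map (λ { refl → Equivalence.from (ball-fires⇔ a₀ y δ) ℕP.≤-refl })
                            (∈-map⁺ (λ ac → ball (proj₁ ac) δ , proj₂ ac) a₀∈)

  ballLayers-nearest : ∀ r c → r ℕ.≤ δ → δ ℕ.< r ℕ.+ c → ldlEval (ballLayers pts r c) y ≡ b
  ballLayers-nearest r zero r≤δ δ<r+0 =
    ⊥-elim (ℕP.<-irrefl refl (ℕP.<-≤-trans δ<r+0 (subst (ℕ._≤ δ) (Eq.sym (ℕP.+-identityʳ r)) r≤δ)))
  ballLayers-nearest r (suc c) r≤δ δ<r+c with r ℕ.≟ δ
  ... | yes refl = ldlEval-++-fires y (ballLayer pts r) _ (ballLayer-agrees r≤δ) ballLayer-fires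
  ... | no r≢δ with ldlEval-++-uniform y (ballLayer pts r) (ballLayers pts (suc r) c) (ballLayer-agrees r≤δ)
  ...   | inj₁ outputs-b = outputs-b
  ...   | inj₂ falls-through = trans falls-through
          (ballLayers-nearest (suc r) c (ℕP.≤∧≢⇒< r≤δ r≢δ) (subst (δ ℕ.<_) (ℕP.+-suc r c) δ<r+c))

  ballLDL-nearest : ldlEval (ballLDL pts) y ≡ b
  ballLDL-nearest = ballLayers-nearest 0 (suc n) ℕ.z≤n (ℕ.s≤s (hamming≤length y a₀))

side : ∀ {A : Set} → List A → List A → Bool → List A
side P N c = if c then P else N

labelled : ∀ {n} → List (Vec Bool n) → List (Vec Bool n) → LabelledPoints n
labelled P N = L.map (_, true) P ++ L.map (_, false) N

∈-labelled⁺ : ∀ {n} {P N : List (Vec Bool n)} {a} c → a ∈ side P N c → (a , c) ∈ labelled P N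
∈-labelled⁺ true a∈ = ∈-++⁺ˡ (∈-map⁺ (_, true) a∈)
∈-labelled⁺ {P = P} false a∈ = ∈-++⁺ʳ (L.map (_, true) P) (∈-map⁺ (_, false) a∈)

∈-labelled⁻ : ∀ {n} {P N : List (Vec Bool n)} {a c} → (a , c) ∈ labelled P N → a ∈ side P N c
∈-labelled⁻ {P = P} ac∈ with ∈-++⁻ (L.map (_, true) P) ac∈
... | inj₁ ∈P with ∈-map⁻ (_, true) ∈P
...   | _ , a∈ , refl = a∈
∈-labelled⁻ {P = P} ac∈ | inj₂ ∈N with ∈-map⁻ (_, false) ∈N
...   | _ , a∈ , refl = a∈

hamming-nearer : ∀ {n} (y : Vec Bool n) {a a′} {B : List (Vec Bool n)} →
  All (λ q → Δ y (embed a) ℚ.< Δ y q) (L.map embed B) → a′ ∈ B → hamming y a ℕ.< hamming y a′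
hamming-nearer y {a} {a′} beats a′∈ = ℤP.drop‿+<+ (fromℤ-cancel-<
  (subst₂ ℚ._<_ (Δ-embed y a) (Δ-embed y a′) (All.lookup beats (∈-map⁺ embed a′∈))))

ballLDL-labelled-nearest : ∀ {n} (y : Vec Bool n) (P N : List (Vec Bool n)) b {a} → a ∈ side P N b →
  All (λ q → Δ y (embed a) ℚ.< Δ y q) (L.map embed (side P N (not b))) →
  ldlEval (ballLDL (labelled P N)) y ≡ b
ballLDL-labelled-nearest y P N b a∈ beats = ballLDL-nearest y (labelled P N) (∈-labelled⁺ b a∈)
  (λ ac∈ c≢b → hamming-nearer y beats (subst (λ c → _ ∈ side P N c) (¬-not c≢b) (∈-labelled⁻ ac∈)))

ballLDL-computes : ∀ {n} (P N : List (Vec Bool n)) {f} →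
  NNRep (L.map embed P) (L.map embed N) f → Computes (ballLDL (labelled P N)) f
ballLDL-computes P N {f} (_ , rep) y with f y in fy
... | true with proj₁ (rep y) fy
...   | _ , p∈ , beats with ∈-map⁻ embed p∈
...     | a , a∈ , refl = ballLDL-labelled-nearest y P N true a∈ beats
ballLDL-computes P N {f} (_ , rep) y | false with proj₂ (rep y) fy
...   | _ , q∈ , beats with ∈-map⁻ embed q∈
...     | a , a∈ , refl = ballLDL-labelled-nearest y P N false a∈ beats

length-labelled : ∀ {n} (P N : List (Vec Bool n)) → length (labelled P N) ≡ length P ℕ.+ length N
length-labelled P N = trans (LP.length-++ (L.map (_, true) P)) (cong₂ ℕ._+_ (LP.length-map _ P) (LP.length-map _ N))

length-ballLayers : ∀ {n} (pts : LabelledPoints n) r c → length (ballLayers pts r c) ≡ c ℕ.* length pts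
length-ballLayers pts r zero = refl
length-ballLayers pts r (suc c) = trans (LP.length-++ (ballLayer pts r))
  (cong₂ ℕ._+_ (LP.length-map _ pts) (length-ballLayers pts (suc r) c))

signs-bounded : ∀ {n} (a : Vec Bool n) → VAll.All (λ z → ℤ.∣ z ∣ ℕ.≤ 1) (signs a)
signs-bounded [] = VAll.[]
signs-bounded (true ∷ a) = ℕP.≤-refl VAll.∷ signs-bounded a
signs-bounded (false ∷ a) = ℕP.≤-refl VAll.∷ signs-bounded a

ballLayers-weights : ∀ {n} (pts : LabelledPoints n) r c → MaxWeightBounded 1 (ballLayers pts r c)
ballLayers-weights pts r zero = []
ballLayers-weights pts r (suc c) = AllP.++⁺ (AllP.map⁺ (All.tabulate (λ {ac} _ → signs-bounded (proj₁ ac))))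
                                            (ballLayers-weights pts (suc r) c)

HNN⊆LDLpoly : ∀ F → HNN F → LDLpoly F
HNN⊆LDLpoly F (k , hnn) = suc k , λ n → ldl n (hnn n)
  where
  ldl : ∀ n → ∃[ P ] ∃[ N ] (length P ℕ.+ length N ℕ.≤ polyBound k n × NNRep (L.map embed P) (L.map embed N) (F n)) →
        ∃[ L ] (length L ℕ.≤ polyBound (suc k) n × MaxWeightBounded (polyBound (suc k) n) L × Computes L (F n))
  ldl n (P , N , size , rep) = ballLDL (labelled P N) , length≤ , weights≤ , ballLDL-computes P N rep
    where
    open ℕP.≤-Reasoning
    length≤ : length (ballLDL (labelled P N)) ℕ.≤ polyBound (suc k) n
    length≤ = begin
      length (ballLDL (labelled P N))    ≡⟨ length-ballLayers (labelled P N) 0 (suc n) ⟩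
      suc n ℕ.* length (labelled P N)   ≡⟨ cong (suc n ℕ.*_) (length-labelled P N) ⟩
      suc n ℕ.* (length P ℕ.+ length N) ≤⟨ ℕP.*-monoʳ-≤ (suc n) size ⟩
      suc n ℕ.* polyBound k n           ≤⟨ polyBound-suc k n ⟩
      polyBound (suc k) n ∎
    weights≤ : MaxWeightBounded (polyBound (suc k) n) (ballLDL (labelled P N))
    weights≤ = MaxWeightBounded-weaken _ (polyBound-suc-positive k n) (ballLayers-weights (labelled P N) 0 (suc n))

substAffine : ∀ {n m} → Substitution n m → Vec ℤ m → Vec ℤ n × ℤ
substAffine [] [] = V.replicate _ (+ 0) , + 0
substAffine (inj₁ i ∷ σ) (a ∷ w) = V.updateAt (proj₁ (substAffine σ w)) i (ℤ._+_ a) , proj₂ (substAffine σ w)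
substAffine (inj₂ b ∷ σ) (a ∷ w) = proj₁ (substAffine σ w) , a ℤ.* bℤ b ℤ.+ proj₂ (substAffine σ w)

inner-zeros : ∀ {n} (x : Vec Bool n) → inner (V.replicate n (+ 0)) x ≡ + 0
inner-zeros [] = refl
inner-zeros (b ∷ x) = cong (ℤ._+_ (+ 0 ℤ.* bℤ b)) (inner-zeros x)

inner-updateAt : ∀ {n} (w : Vec ℤ n) (x : Vec Bool n) i a →
  inner (V.updateAt w i (ℤ._+_ a)) x ≡ a ℤ.* bℤ (V.lookup x i) ℤ.+ inner w x
inner-updateAt (z ∷ w) (b ∷ x) zero a =
  solve 4 (λ a z B R → (a :+ z) :* B :+ R := a :* B :+ (z :* B :+ R)) refl a z (bℤ b) (inner w x)
inner-updateAt (z ∷ w) (b ∷ x) (suc i) a = trans (cong (ℤ._+_ (z ℤ.* bℤ b)) (inner-updateAt w x i a))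
  (solve 4 (λ a Z B R → Z :+ (a :* B :+ R) := a :* B :+ (Z :+ R)) refl a (z ℤ.* bℤ b) (bℤ (V.lookup x i)) (inner w x))

inner-applySubst : ∀ {n m} (σ : Substitution n m) (w : Vec ℤ m) (x : Vec Bool n) →
  inner w (applySubst σ x) ≡ inner (proj₁ (substAffine σ w)) x ℤ.+ proj₂ (substAffine σ w)
inner-applySubst [] [] x = Eq.sym (cong (ℤ._+ + 0) (inner-zeros x))
inner-applySubst {n} (inj₁ i ∷ σ) (a ∷ w) x = begin
  a ℤ.* bℤ (V.lookup x i) ℤ.+ inner w (applySubst σ x)  ≡⟨ cong (ℤ._+_ (a ℤ.* bℤ (V.lookup x i))) (inner-applySubst σ w x) ⟩
  a ℤ.* bℤ (V.lookup x i) ℤ.+ (inner v x ℤ.+ c)        ≡⟨ Eq.sym (ℤP.+-assoc (a ℤ.* bℤ (V.lookup x i)) (inner v x) c) ⟩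
  a ℤ.* bℤ (V.lookup x i) ℤ.+ inner v x ℤ.+ c          ≡⟨ cong (ℤ._+ c) (Eq.sym (inner-updateAt v x i a)) ⟩
  inner (V.updateAt v i (ℤ._+_ a)) x ℤ.+ c ∎
  where
  open ≡-Reasoning
  v : Vec ℤ n
  v = proj₁ (substAffine σ w)
  c : ℤ
  c = proj₂ (substAffine σ w)
inner-applySubst (inj₂ b ∷ σ) (a ∷ w) x = trans (cong (ℤ._+_ (a ℤ.* bℤ b)) (inner-applySubst σ w x))
  (solve 3 (λ A I c → A :+ (I :+ c) := I :+ (A :+ c)) refl (a ℤ.* bℤ b) (inner (proj₁ (substAffine σ w)) x) (proj₂ (substAffine σ w)))

i-k≤j⇔i≤j+k : ∀ i j k → (i ℤ.- k ℤ.≤ j) ⇔ (i ℤ.≤ j ℤ.+ k)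
i-k≤j⇔i≤j+k i j k = mk⇔
  (λ le → subst (ℤ._≤ j ℤ.+ k) (solve 2 (λ i k → i :- k :+ k := i) refl i k) (ℤP.+-monoˡ-≤ k le))
  (λ le → subst (i ℤ.- k ℤ.≤_) (solve 2 (λ j k → j :+ k :- k := j) refl j k) (ℤP.+-monoˡ-≤ (ℤ.- k) le))

substGate : ∀ {n m} → Substitution n m → Gate m → Gate n
substGate σ (gate w θ) = gate (proj₁ (substAffine σ w)) (θ ℤ.- proj₂ (substAffine σ w))

substGate-eval : ∀ {n m} (σ : Substitution n m) g x → gateEval (substGate σ g) x ≡ gateEval g (applySubst σ x)
substGate-eval {n} σ (gate w θ) x = gateEval-cong
  (subst (λ t → (θ ℤ.- c ℤ.≤ inner v x) ⇔ (θ ℤ.≤ t)) (Eq.sym (inner-applySubst σ w x)) (i-k≤j⇔i≤j+k θ (inner v x) c))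
  where
  v : Vec ℤ n
  v = proj₁ (substAffine σ w)
  c : ℤ
  c = proj₂ (substAffine σ w)

substLDL : ∀ {n m} → Substitution n m → LDList m → LDList n
substLDL σ = L.map (λ gc → substGate σ (proj₁ gc) , proj₂ gc)

substLDL-eval : ∀ {n m} (σ : Substitution n m) (L : LDList m) x → ldlEval (substLDL σ L) x ≡ ldlEval L (applySubst σ x)
substLDL-eval σ [] x = refl
substLDL-eval σ ((g , c) ∷ L) x rewrite substGate-eval σ g x | substLDL-eval σ L x = refl

updateAt-bounded : ∀ {n} (w : Vec ℤ n) i a {W K} → VAll.All (λ z → ℤ.∣ z ∣ ℕ.≤ K) w → ℤ.∣ a ∣ ℕ.≤ W →
  VAll.All (λ z → ℤ.∣ z ∣ ℕ.≤ W ℕ.+ K) (V.updateAt w i (ℤ._+_ a))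
updateAt-bounded (z ∷ w) zero a {W} (∣z∣≤ VAll.∷ w≤) ∣a∣≤ =
  ℕP.≤-trans (ℤP.∣i+j∣≤∣i∣+∣j∣ a z) (ℕP.+-mono-≤ ∣a∣≤ ∣z∣≤) VAll.∷ VAll.map (λ p → ℕP.≤-trans p (ℕP.m≤n+m _ W)) w≤
updateAt-bounded (z ∷ w) (suc i) a {W} (∣z∣≤ VAll.∷ w≤) ∣a∣≤ =
  ℕP.≤-trans ∣z∣≤ (ℕP.m≤n+m _ W) VAll.∷ updateAt-bounded w i a w≤ ∣a∣≤

substAffine-bounded : ∀ {n m} (σ : Substitution n m) (w : Vec ℤ m) {W} → VAll.All (λ z → ℤ.∣ z ∣ ℕ.≤ W) w →
  VAll.All (λ z → ℤ.∣ z ∣ ℕ.≤ m ℕ.* W) (proj₁ (substAffine σ w))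
substAffine-bounded [] [] _ = zeros-bounded _
  where
  zeros-bounded : ∀ n {W} → VAll.All (λ z → ℤ.∣ z ∣ ℕ.≤ W) (V.replicate n (+ 0))
  zeros-bounded zero = VAll.[]
  zeros-bounded (suc n) = ℕ.z≤n VAll.∷ zeros-bounded n
substAffine-bounded (inj₁ i ∷ σ) (a ∷ w) (∣a∣≤ VAll.∷ w≤) = updateAt-bounded _ i a (substAffine-bounded σ w w≤) ∣a∣≤
substAffine-bounded (inj₂ b ∷ σ) (a ∷ w) {W} (_ VAll.∷ w≤) =
  VAll.map (λ p → ℕP.≤-trans p (ℕP.m≤n+m _ W)) (substAffine-bounded σ w w≤)

substLDL-weights : ∀ {n m} (σ : Substitution n m) (L : LDList m) {W} →
  MaxWeightBounded W L → MaxWeightBounded (m ℕ.* W) (substLDL σ L)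
substLDL-weights σ [] [] = []
substLDL-weights σ ((gate w θ , c) ∷ L) (w≤ ∷ L≤) = substAffine-bounded σ w w≤ ∷ substLDL-weights σ L L≤

closureLDLpoly⊆LDLpoly : ∀ F → closure LDLpoly F → LDLpoly F
closureLDLpoly⊆LDLpoly F (G , (kG , ldl) , k , sub) = K , λ n → ldlAt n (sub n)
  where
  K : ℕ
  K = suc kG ℕ.* suc k ℕ.^ suc kG ℕ.+ k ℕ.* suc kG
  ldlAt : ∀ n → ∃[ m ] (m ℕ.≤ polyBound k n × ∃[ σ ] (∀ x → F n x ≡ G m (applySubst {n} {m} σ x))) →
    ∃[ L ] (length L ℕ.≤ polyBound K n × MaxWeightBounded (polyBound K n) L × Computes L (F n))
  ldlAt n (m , m≤ , σ , F≡G∘σ) with ldl m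
  ... | L , length≤ , weights≤ , computes = substLDL σ L , length≤′ , weights≤′ ,
    λ x → trans (substLDL-eval σ L x) (trans (computes (applySubst σ x)) (Eq.sym (F≡G∘σ x)))
    where
    grow : polyBound (suc kG) m ℕ.≤ polyBound K n
    grow = polyBound-∘ k (suc kG) m≤
    length≤′ : length (substLDL σ L) ℕ.≤ polyBound K n
    length≤′ = ℕP.≤-trans (ℕP.≤-reflexive (LP.length-map _ L))
                 (ℕP.≤-trans length≤ (ℕP.≤-trans (polyBound-monoˡ m (ℕP.n≤1+n kG)) grow))
    weights≤′ : MaxWeightBounded (polyBound K n) (substLDL σ L)
    weights≤′ = MaxWeightBounded-weaken _ (ℕP.≤-trans (ℕP.*-monoˡ-≤ _ (ℕP.n≤1+n m)) (ℕP.≤-trans (polyBound-suc kG m) grow))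
                  (substLDL-weights σ L weights≤)

i≤∣i∣ : ∀ i → i ℤ.≤ + ℤ.∣ i ∣
i≤∣i∣ (+ n) = ℤP.≤-refl
i≤∣i∣ ℤ.-[1+ n ] = ℤ.-≤+

sumAbs : ∀ {n} → Vec ℤ n → ℕ
sumAbs [] = 0
sumAbs (z ∷ w) = ℤ.∣ z ∣ ℕ.+ sumAbs w

inner≤sumAbs : ∀ {n} (w : Vec ℤ n) x → inner w x ℤ.≤ + sumAbs w
inner≤sumAbs [] [] = ℤP.≤-refl
inner≤sumAbs (z ∷ w) (b ∷ x) = subst (inner (z ∷ w) (b ∷ x) ℤ.≤_) (Eq.sym (ℤP.pos-+ ℤ.∣ z ∣ (sumAbs w)))
  (ℤP.+-mono-≤ (term b) (inner≤sumAbs w x))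
  where
  term : ∀ b → z ℤ.* bℤ b ℤ.≤ + ℤ.∣ z ∣
  term true = subst (ℤ._≤ + ℤ.∣ z ∣) (Eq.sym (ℤP.*-identityʳ z)) (i≤∣i∣ z)
  term false = subst (ℤ._≤ + ℤ.∣ z ∣) (Eq.sym (ℤP.*-zeroʳ z)) (ℤ.+≤+ ℕ.z≤n)

margin : ∀ {n} → Gate n → Vec Bool n → ℤ
margin (gate w θ) x = inner w x ℤ.- θ

gateNorm : ∀ {n} → Gate n → ℕ
gateNorm (gate w θ) = sumAbs w ℕ.+ ℤ.∣ θ ∣

margin≤gateNorm : ∀ {n} (g : Gate n) x → margin g x ℤ.≤ + gateNorm g
margin≤gateNorm (gate w θ) x = subst (margin (gate w θ) x ℤ.≤_) (Eq.sym (ℤP.pos-+ (sumAbs w) ℤ.∣ θ ∣))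
  (ℤP.+-mono-≤ (inner≤sumAbs w x) (subst (ℤ.- θ ℤ.≤_) (cong +_ (ℤP.∣-i∣≡∣i∣ θ)) (i≤∣i∣ (ℤ.- θ))))

fires⇒0≤margin : ∀ {n} (w : Vec ℤ n) θ x → θ ℤ.≤ inner w x → + 0 ℤ.≤ margin (gate w θ) x
fires⇒0≤margin w θ x = ℤP.i≤j⇒0≤j-i

silent⇒margin<0 : ∀ {n} (w : Vec ℤ n) θ x → ¬ θ ℤ.≤ inner w x → margin (gate w θ) x ℤ.< + 0
silent⇒margin<0 w θ x θ≰ =
  subst (margin (gate w θ) x ℤ.<_) (ℤP.+-inverseʳ θ) (ℤP.+-monoˡ-< (ℤ.- θ) (ℤP.≰⇒> θ≰))

Form : ℕ → Set
Form n = Vec ℤ (suc n) × Bool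

value : ∀ {n} → Form n → Vec Bool n → ℤ
value f x = inner (proj₁ f) (true ∷ x)

zeroForm : ∀ {n} → Form n
zeroForm = V.replicate _ (+ 0) , false

gateForm : ∀ {n} → ℕ → Gate n → Bool → Form n
gateForm R (gate w θ) c = + R ℤ.* (+ 1 ℤ.- + 2 ℤ.* θ) ∷ V.map (+ (2 ℕ.* R) ℤ.*_) w , c

inner-scale : ∀ {n} k (w : Vec ℤ n) x → inner (V.map (k ℤ.*_) w) x ≡ k ℤ.* inner w x
inner-scale k [] [] = Eq.sym (ℤP.*-zeroʳ k)
inner-scale k (z ∷ w) (b ∷ x) = trans (cong (ℤ._+_ (k ℤ.* z ℤ.* bℤ b)) (inner-scale k w x))
  (solve 4 (λ k z B I → k :* z :* B :+ k :* I := k :* (z :* B :+ I)) refl k z (bℤ b) (inner w x))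

value-gateForm : ∀ {n} R (g : Gate n) c x → value (gateForm R g c) x ≡ + R ℤ.* (+ 1 ℤ.+ + 2 ℤ.* margin g x)
value-gateForm R (gate w θ) c x = begin
  + R ℤ.* (+ 1 ℤ.- + 2 ℤ.* θ) ℤ.* + 1 ℤ.+ inner (V.map (+ (2 ℕ.* R) ℤ.*_) w) x
    ≡⟨ cong (ℤ._+_ (+ R ℤ.* (+ 1 ℤ.- + 2 ℤ.* θ) ℤ.* + 1)) (inner-scale (+ (2 ℕ.* R)) w x) ⟩
  + R ℤ.* (+ 1 ℤ.- + 2 ℤ.* θ) ℤ.* + 1 ℤ.+ + (2 ℕ.* R) ℤ.* inner w x
    ≡⟨ cong (λ t → + R ℤ.* (+ 1 ℤ.- + 2 ℤ.* θ) ℤ.* + 1 ℤ.+ t ℤ.* inner w x) (ℤP.pos-* 2 R) ⟩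
  + R ℤ.* (+ 1 ℤ.- + 2 ℤ.* θ) ℤ.* + 1 ℤ.+ + 2 ℤ.* + R ℤ.* inner w x
    ≡⟨ solve 3 (λ R θ I → R :* (con (+ 1) :- con (+ 2) :* θ) :* con (+ 1) :+ con (+ 2) :* R :* I
                   := R :* (con (+ 1) :+ con (+ 2) :* (I :- θ))) refl (+ R) θ (inner w x) ⟩
  + R ℤ.* (+ 1 ℤ.+ + 2 ℤ.* margin (gate w θ) x) ∎
  where open ≡-Reasoning

value-zeroForm : ∀ {n} (x : Vec Bool n) → value zeroForm x ≡ + 0
value-zeroForm x = inner-zeros (true ∷ x)

value-gateForm-fires : ∀ {n} R (g : Gate n) c x → + 0 ℤ.≤ margin g x →
  + R ℤ.≤ value (gateForm R g c) x × value (gateForm R g c) x ℤ.≤ + (R ℕ.* suc (2 ℕ.* gateNorm g))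
value-gateForm-fires R g c x 0≤margin rewrite value-gateForm R g c x = lower , upper
  where
  odd : ℤ
  odd = + 1 ℤ.+ + 2 ℤ.* margin g x
  1≤odd : + 1 ℤ.≤ odd
  1≤odd = ℤP.+-monoʳ-≤ (+ 1) (ℤP.*-monoˡ-≤-nonNeg (+ 2) 0≤margin)
  odd≤ : odd ℤ.≤ + suc (2 ℕ.* gateNorm g)
  odd≤ = subst (odd ℤ.≤_) (cong (ℤ._+_ (+ 1)) (Eq.sym (ℤP.pos-* 2 (gateNorm g))))
    (ℤP.+-monoʳ-≤ (+ 1) (ℤP.*-monoˡ-≤-nonNeg (+ 2) (margin≤gateNorm g x)))
  lower : + R ℤ.≤ + R ℤ.* odd
  lower = subst (ℤ._≤ + R ℤ.* odd) (ℤP.*-identityʳ (+ R)) (ℤP.*-monoˡ-≤-nonNeg (+ R) 1≤odd)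
  upper : + R ℤ.* odd ℤ.≤ + (R ℕ.* suc (2 ℕ.* gateNorm g))
  upper = subst (+ R ℤ.* odd ℤ.≤_) (Eq.sym (ℤP.pos-* R _)) (ℤP.*-monoˡ-≤-nonNeg (+ R) odd≤)

value-gateForm-silent : ∀ {n} R (g : Gate n) c x → margin g x ℤ.< + 0 → value (gateForm (suc R) g c) x ℤ.< + 0
value-gateForm-silent R g c x margin<0 rewrite value-gateForm (suc R) g c x =
  subst (+ suc R ℤ.* odd ℤ.<_) (ℤP.*-zeroʳ (+ suc R)) (ℤP.*-monoˡ-<-pos (+ suc R) odd<0)
  where
  odd : ℤ
  odd = + 1 ℤ.+ + 2 ℤ.* margin g x
  odd<0 : odd ℤ.< + 0
  odd<0 = subst (ℤ._< + 0) (solve 1 (λ m → (con (+ 1) :+ m) :+ m := con (+ 1) :+ con (+ 2) :* m) refl (margin g x))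
    (ℤP.+-mono-≤-< (ℤP.i<j⇒suc[i]≤j margin<0) margin<0)

formsBound : ∀ {n} → LDList n → ℕ
formsBound [] = 0
formsBound ((g , _) ∷ L) = suc (formsBound L) ℕ.* suc (2 ℕ.* gateNorm g)

forms : ∀ {n} → LDList n → List (Form n)
forms [] = zeroForm ∷ []
forms ((g , c) ∷ L) = gateForm (suc (formsBound L)) g c ∷ forms L

formsBound-step : ∀ {n} (g : Gate n) c L → suc (formsBound L) ℕ.≤ formsBound ((g , c) ∷ L)
formsBound-step g c L = ℕP.m≤m*n (suc (formsBound L)) (suc (2 ℕ.* gateNorm g))

zeroForm∈forms : ∀ {n} (L : LDList n) → zeroForm ∈ forms L
zeroForm∈forms [] = here refl
zeroForm∈forms (_ ∷ L) = there (zeroForm∈forms L)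

length-forms : ∀ {n} (L : LDList n) → length (forms L) ≡ suc (length L)
length-forms [] = refl
length-forms (_ ∷ L) = cong suc (length-forms L)

forms-bounded : ∀ {n} (L : LDList n) x → All (λ f → value f x ℤ.≤ + formsBound L) (forms L)
forms-bounded [] x = ℤP.≤-reflexive (value-zeroForm x) ∷ []
forms-bounded ((gate w θ , c) ∷ L) x = new≤ ∷ All.map (λ f≤T → ℤP.≤-trans f≤T (ℤ.+≤+ T≤T′)) (forms-bounded L x)
  where
  T≤T′ : formsBound L ℕ.≤ formsBound ((gate w θ , c) ∷ L)
  T≤T′ = ℕP.<⇒≤ (formsBound-step (gate w θ) c L)
  new≤ : value (gateForm (suc (formsBound L)) (gate w θ) c) x ℤ.≤ + formsBound ((gate w θ , c) ∷ L)
  new≤ with θ ℤ.≤? inner w x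
  ... | yes θ≤ = proj₂ (value-gateForm-fires (suc (formsBound L)) (gate w θ) c x (fires⇒0≤margin w θ x θ≤))
  ... | no θ≰ = ℤP.<⇒≤ (ℤP.<-≤-trans (value-gateForm-silent (formsBound L) (gate w θ) c x (silent⇒margin<0 w θ x θ≰)) (ℤ.+≤+ ℕ.z≤n))

record Winner {n} (fs : List (Form n)) (x : Vec Bool n) (b : Bool) : Set where
  constructor winner
  field
    form : Form n
    form∈ : form ∈ fs
    label : proj₂ form ≡ b
    nonNegative : + 0 ℤ.≤ value form x
    beats : ∀ {f} → f ∈ fs → proj₂ f ≢ proj₂ form → value f x ℤ.< value form x

forms-winner : ∀ {n} (L : LDList n) x → Winner (forms L) x (ldlEval L x)
forms-winner [] x = winner zeroForm (here refl) refl (ℤP.≤-reflexive (Eq.sym (value-zeroForm x)))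
  λ { (here refl) differ → ⊥-elim (differ refl) ; (there ()) }
forms-winner {n} ((gate w θ , c) ∷ L) x with θ ℤ.≤? inner w x
... | yes θ≤ = winner new (here refl) refl (ℤP.≤-trans (ℤ.+≤+ ℕ.z≤n) new-large) beats
  where
  new : Form n
  new = gateForm (suc (formsBound L)) (gate w θ) c
  new-large : + suc (formsBound L) ℤ.≤ value new x
  new-large = proj₁ (value-gateForm-fires (suc (formsBound L)) (gate w θ) c x (fires⇒0≤margin w θ x θ≤))
  beats : ∀ {f} → f ∈ new ∷ forms L → proj₂ f ≢ c → value f x ℤ.< value new x
  beats (here refl) differ = ⊥-elim (differ refl)
  beats (there f∈) _ = ℤP.≤-<-trans (All.lookup (forms-bounded L x) f∈) (ℤP.<-≤-trans (ℤ.+<+ (ℕP.n<1+n _)) new-large)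
... | no θ≰ with forms-winner L x
...   | winner f₀ f₀∈ label nonNegative beats = winner f₀ (there f₀∈) label nonNegative beats′
  where
  new : Form n
  new = gateForm (suc (formsBound L)) (gate w θ) c
  beats′ : ∀ {f} → f ∈ new ∷ forms L → proj₂ f ≢ proj₂ f₀ → value f x ℤ.< value f₀ x
  beats′ (here refl) _ = ℤP.<-≤-trans (value-gateForm-silent (formsBound L) (gate w θ) c x (silent⇒margin<0 w θ x θ≰)) nonNegative
  beats′ (there f∈) = beats f∈

Beats : ∀ {n} → Vec Bool n → Vec ℚ n → List (Vec ℚ n) → Set
Beats y p Q = All (λ q → Δ y p ℚ.< Δ y q) Q

beats? : ∀ {n} y p (Q : List (Vec ℚ n)) → Dec (Beats y p Q)
beats? y p Q = All.all? (λ q → Δ y p ℚ.<? Δ y q) Q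

nearestPositive : ∀ {n} → List (Vec ℚ n) → List (Vec ℚ n) → Vec Bool n → Bool
nearestPositive P N y = does (Any.any? (λ p → beats? y p N) P)

module _ {n} (P N : List (Vec ℚ n)) {q₀ : Vec ℚ n} (q₀∈ : q₀ ∈ N)
         (no-ties : ∀ y {p q} → p ∈ P → q ∈ N → Δ y p ≢ Δ y q) where

  nnRep-nearestPositive : NNRep P N (nearestPositive P N)
  nnRep-nearestPositive = disjoint , λ y → positive y , negative y
    where
    disjoint : ∀ p → p ∈ P → ¬ p ∈ N
    disjoint p p∈P p∈N = no-ties (V.replicate n false) p∈P p∈N refl

    positive : ∀ y → nearestPositive P N y ≡ true → ∃[ p ] (p ∈ P × Beats y p N)
    positive y is-true with Any.any? (λ p → beats? y p N) P
    positive y refl | yes found = find found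

    negative : ∀ y → nearestPositive P N y ≡ false → ∃[ q ] (q ∈ N × Beats y q P)
    negative y is-false = q , q∈ , All.tabulate q-beats
      where
      q : Vec ℚ n
      q = argmin (Δ y) q₀ N
      q∈ : q ∈ N
      q∈ = argmin-all (Δ y) q₀∈ (All.tabulate (λ q′∈ → q′∈))
      q-beats : ∀ {p} → p ∈ P → Δ y q ℚ.< Δ y p
      q-beats {p} p∈ with ℚP.<-cmp (Δ y p) (Δ y q)
      ... | tri< p<q _ _ = ⊥-elim (no-positive-beats (lose p∈ (All.map (ℚP.<-≤-trans p<q) (f[argmin]≤f[xs] q₀ N))))
        where
        no-positive-beats : ¬ Any (λ p → Beats y p N) P
        no-positive-beats found with trans (Eq.sym is-false) (dec-true (Any.any? (λ p → beats? y p N) P) found)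
        ... | ()
      ... | tri≈ _ p≡q _ = ⊥-elim (no-ties y p∈ q∈ p≡q)
      ... | tri> _ _ q<p = q<p

normSq-++ : ∀ {k l} (u : Vec ℤ k) (v : Vec ℤ l) → normSq (u V.++ v) ≡ normSq u ℤ.+ normSq v
normSq-++ [] v = Eq.sym (ℤP.+-identityˡ _)
normSq-++ (a ∷ u) v = trans (cong (ℤ._+_ (a ℤ.* a)) (normSq-++ u v)) (Eq.sym (ℤP.+-assoc (a ℤ.* a) (normSq u) (normSq v)))

normSq-zeros : ∀ k → normSq (V.replicate k (+ 0)) ≡ + 0
normSq-zeros zero = refl
normSq-zeros (suc k) = trans (ℤP.+-identityˡ _) (normSq-zeros k)

normSq-concat-erase : ∀ {k N} (vs : Vec (Vec ℤ k) N) j →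
  normSq (V.lookup vs j) ℤ.+ normSq (V.concat (V.updateAt vs j (λ _ → V.replicate k (+ 0)))) ≡ normSq (V.concat vs)
normSq-concat-erase {k} (v ∷ vs) zero = begin
  normSq v ℤ.+ normSq (V.replicate k (+ 0) V.++ V.concat vs)  ≡⟨ cong (ℤ._+_ (normSq v)) (normSq-++ (V.replicate k (+ 0)) _) ⟩
  normSq v ℤ.+ (normSq (V.replicate k (+ 0)) ℤ.+ normSq (V.concat vs))
    ≡⟨ cong (λ t → normSq v ℤ.+ (t ℤ.+ normSq (V.concat vs))) (normSq-zeros k) ⟩
  normSq v ℤ.+ (+ 0 ℤ.+ normSq (V.concat vs))                 ≡⟨ cong (ℤ._+_ (normSq v)) (ℤP.+-identityˡ _) ⟩
  normSq v ℤ.+ normSq (V.concat vs)                            ≡⟨ Eq.sym (normSq-++ v (V.concat vs)) ⟩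
  normSq (v V.++ V.concat vs) ∎
  where open ≡-Reasoning
normSq-concat-erase {k} {suc N} (v ∷ vs) (suc j) = begin
  normSq (V.lookup vs j) ℤ.+ normSq (v V.++ V.concat erased)
    ≡⟨ cong (ℤ._+_ (normSq (V.lookup vs j))) (normSq-++ v (V.concat erased)) ⟩
  normSq (V.lookup vs j) ℤ.+ (normSq v ℤ.+ normSq (V.concat erased))
    ≡⟨ solve 3 (λ a b c → a :+ (b :+ c) := b :+ (a :+ c)) refl (normSq (V.lookup vs j)) (normSq v) (normSq (V.concat erased)) ⟩
  normSq v ℤ.+ (normSq (V.lookup vs j) ℤ.+ normSq (V.concat erased))
    ≡⟨ cong (ℤ._+_ (normSq v)) (normSq-concat-erase vs j) ⟩
  normSq v ℤ.+ normSq (V.concat vs)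
    ≡⟨ Eq.sym (normSq-++ v (V.concat vs)) ⟩
  normSq (v V.++ V.concat vs) ∎
  where
  open ≡-Reasoning
  erased : Vec (Vec ℤ k) N
  erased = V.updateAt vs j (λ _ → V.replicate k (+ 0))

inner-++ : ∀ {k l} (u : Vec ℤ k) (v : Vec ℤ l) y z → inner (u V.++ v) (y V.++ z) ≡ inner u y ℤ.+ inner v z
inner-++ [] v [] z = Eq.sym (ℤP.+-identityˡ _)
inner-++ (a ∷ u) v (b ∷ y) z = trans (cong (ℤ._+_ (a ℤ.* bℤ b)) (inner-++ u v y z))
  (Eq.sym (ℤP.+-assoc (a ℤ.* bℤ b) (inner u y) (inner v z)))

inner-falses : ∀ {k} (w : Vec ℤ k) → inner w (V.replicate k false) ≡ + 0
inner-falses [] = refl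
inner-falses (a ∷ w) = trans (cong (ℤ._+_ (a ℤ.* + 0)) (inner-falses w)) (trans (ℤP.+-identityʳ _) (ℤP.*-zeroʳ a))

bℤ-idem : ∀ b → bℤ b ℤ.* bℤ b ≡ bℤ b
bℤ-idem true = refl
bℤ-idem false = refl

1≢2* : ∀ k → + 1 ≢ + 2 ℤ.* k
1≢2* (+ zero) ()
1≢2* (+ suc k) 1≡2k = ℕP.m+1+n≢0 k (Eq.sym (ℕP.suc-injective (ℤP.+-injective (trans 1≡2k (Eq.sym (ℤP.pos-* 2 (suc k)))))))
1≢2* ℤ.-[1+ k ] ()

parity-gap : ∀ S Q I I′ → S ℤ.+ (+ 1 ℤ.+ Q) ℤ.- + 2 ℤ.* I ≢ S ℤ.+ (+ 0 ℤ.+ Q) ℤ.- + 2 ℤ.* I′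
parity-gap S Q I I′ eq = 1≢2* (I ℤ.- I′) (begin
  + 1                            ≡⟨ solve 4 (λ S Q I I′ → con (+ 1) := S :+ (con (+ 1) :+ Q) :- con (+ 2) :* I
                                                                     :- (S :+ (con (+ 0) :+ Q) :- con (+ 2) :* I′)
                                                                     :+ con (+ 2) :* (I :- I′)) refl S Q I I′ ⟩
  A ℤ.- B ℤ.+ + 2 ℤ.* (I ℤ.- I′) ≡⟨ cong (λ t → t ℤ.- B ℤ.+ + 2 ℤ.* (I ℤ.- I′)) eq ⟩
  B ℤ.- B ℤ.+ + 2 ℤ.* (I ℤ.- I′) ≡⟨ solve 2 (λ B D → B :- B :+ D := D) refl B (+ 2 ℤ.* (I ℤ.- I′)) ⟩
  + 2 ℤ.* (I ℤ.- I′) ∎)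
  where
  open ≡-Reasoning
  A B : ℤ
  A = S ℤ.+ (+ 1 ℤ.+ Q) ℤ.- + 2 ℤ.* I
  B = S ℤ.+ (+ 0 ℤ.+ Q) ℤ.- + 2 ℤ.* I′

larger-value-nearer : ∀ S Q v v′ {l l′} → l ≢ l′ → v′ ℤ.< v →
  S ℤ.+ (bℤ l ℤ.+ Q) ℤ.- + 2 ℤ.* v ℤ.< S ℤ.+ (bℤ l′ ℤ.+ Q) ℤ.- + 2 ℤ.* v′
larger-value-nearer S Q v v′ {l} {l′} l≢l′ v′<v =
  subst (A ℤ.<_) (Eq.sym B≡A+gap) (subst (ℤ._< A ℤ.+ gap) (ℤP.+-identityʳ A) (ℤP.+-monoʳ-< A 0<gap))
  where
  A : ℤ
  A = S ℤ.+ (bℤ l ℤ.+ Q) ℤ.- + 2 ℤ.* v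
  gap : ℤ
  gap = (bℤ l′ ℤ.- bℤ l) ℤ.+ + 2 ℤ.* (v ℤ.- v′)
  B≡A+gap : S ℤ.+ (bℤ l′ ℤ.+ Q) ℤ.- + 2 ℤ.* v′ ≡ A ℤ.+ gap
  B≡A+gap = solve 6 (λ S Q v v′ a b → S :+ (b :+ Q) :- con (+ 2) :* v′ := S :+ (a :+ Q) :- con (+ 2) :* v :+ ((b :- a) :+ con (+ 2) :* (v :- v′)))
              refl S Q v v′ (bℤ l) (bℤ l′)
  -1≤label-diff : ∀ l l′ → l ≢ l′ → ℤ.- + 1 ℤ.≤ bℤ l′ ℤ.- bℤ l
  -1≤label-diff true true l≢l′ = ⊥-elim (l≢l′ refl)
  -1≤label-diff true false _ = ℤP.≤-refl
  -1≤label-diff false true _ = ℤ.-≤+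
  -1≤label-diff false false l≢l′ = ⊥-elim (l≢l′ refl)
  2≤2[v-v′] : + 2 ℤ.≤ + 2 ℤ.* (v ℤ.- v′)
  2≤2[v-v′] = ℤP.*-monoˡ-≤-nonNeg (+ 2) (ℤP.i<j⇒suc[i]≤j (subst (ℤ._< v ℤ.- v′) (ℤP.+-inverseʳ v′) (ℤP.+-monoˡ-< (ℤ.- v′) v′<v)))
  0<gap : + 0 ℤ.< gap
  0<gap = ℤP.<-≤-trans (ℤ.+<+ (ℕ.s≤s ℕ.z≤n)) (ℤP.+-mono-≤ (-1≤label-diff l l′ l≢l′) 2≤2[v-v′])

length-filter-label : ∀ {A : Set} (label : A → Bool) (xs : List A) →
  length (L.filter (λ a → label a Data.Bool.≟ true) xs) ℕ.+ length (L.filter (λ a → label a Data.Bool.≟ false) xs) ≡ length xs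
length-filter-label label [] = refl
length-filter-label label (a ∷ xs) with label a
... | true = cong suc (length-filter-label label xs)
... | false = trans (ℕP.+-suc _ _) (cong suc (length-filter-label label xs))

module Anchors {n N : ℕ} (slots : Vec (Form n) N) where

  dim : ℕ
  dim = suc (suc N ℕ.* suc n)

  label : Fin N → Bool
  label j = proj₂ (V.lookup slots j)

  coefficients : Vec (Vec ℤ (suc n)) N
  coefficients = V.map proj₁ slots

  erased : Fin N → Vec ℤ (N ℕ.* suc n)
  erased j = V.concat (V.updateAt coefficients j (λ _ → V.replicate (suc n) (+ 0)))

  anchor : Fin N → Vec ℤ dim
  anchor j = bℤ (label j) ∷ (V.lookup coefficients j V.++ erased j)

  point : Fin N → Vec ℚ dim
  point j = V.map fromℤ (anchor j)

  indices : Bool → List (Fin N)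
  indices b = L.filter (λ j → label j Data.Bool.≟ b) (L.allFin N)

  anchors : Bool → List (Vec ℚ dim)
  anchors b = L.map point (indices b)

  lift : Vec Bool n → Vec Bool dim
  lift x = false ∷ ((true ∷ x) V.++ V.replicate (N ℕ.* suc n) false)

  Q : ℤ
  Q = normSq (V.concat coefficients)

  normSq-anchor : ∀ j → normSq (anchor j) ≡ bℤ (label j) ℤ.+ Q
  normSq-anchor j = cong₂ ℤ._+_ (bℤ-idem (label j))
    (trans (normSq-++ (V.lookup coefficients j) (erased j)) (normSq-concat-erase coefficients j))

  Δ-point : ∀ y j → Δ y (point j) ≡ fromℤ (ones y ℤ.+ (bℤ (label j) ℤ.+ Q) ℤ.- + 2 ℤ.* inner (anchor j) y)
  Δ-point y j = trans (Δ-fromℤ y (anchor j)) (cong (λ s → fromℤ (ones y ℤ.+ s ℤ.- + 2 ℤ.* inner (anchor j) y)) (normSq-anchor j))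

  inner-anchor-lift : ∀ j x → inner (anchor j) (lift x) ≡ value (V.lookup slots j) x
  inner-anchor-lift j x = begin
    bℤ (label j) ℤ.* + 0 ℤ.+ inner (V.lookup coefficients j V.++ erased j) ((true ∷ x) V.++ V.replicate (N ℕ.* suc n) false)
      ≡⟨ cong₂ ℤ._+_ (ℤP.*-zeroʳ (bℤ (label j))) (inner-++ (V.lookup coefficients j) (erased j) (true ∷ x) _) ⟩
    + 0 ℤ.+ (inner (V.lookup coefficients j) (true ∷ x) ℤ.+ inner (erased j) (V.replicate (N ℕ.* suc n) false))
      ≡⟨ ℤP.+-identityˡ _ ⟩
    inner (V.lookup coefficients j) (true ∷ x) ℤ.+ inner (erased j) (V.replicate (N ℕ.* suc n) false)
      ≡⟨ cong₂ ℤ._+_ (cong (λ v → inner v (true ∷ x)) (VP.lookup-map j proj₁ slots)) (inner-falses (erased j)) ⟩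
    value (V.lookup slots j) x ℤ.+ + 0
      ≡⟨ ℤP.+-identityʳ _ ⟩
    value (V.lookup slots j) x ∎
    where open ≡-Reasoning

  ∈-anchors⁺ : ∀ {b} j → label j ≡ b → point j ∈ anchors b
  ∈-anchors⁺ {b} j lj = ∈-map⁺ point (∈-filter⁺ (λ j → label j Data.Bool.≟ b) (∈-allFin j) lj)

  ∈-anchors⁻ : ∀ {b p} → p ∈ anchors b → ∃[ j ] (label j ≡ b × p ≡ point j)
  ∈-anchors⁻ {b} p∈ with ∈-map⁻ point p∈
  ... | j , j∈ , refl = j , proj₂ (∈-filter⁻ (λ j → label j Data.Bool.≟ b) {xs = L.allFin N} j∈) , refl

  length-anchors : length (anchors true) ℕ.+ length (anchors false) ≡ N
  length-anchors = trans (cong₂ ℕ._+_ (LP.length-map point (indices true)) (LP.length-map point (indices false)))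
                         (trans (length-filter-label label (L.allFin N)) (LP.length-tabulate (λ j → j)))

  no-ties : ∀ y {p q} → p ∈ anchors true → q ∈ anchors false → Δ y p ≢ Δ y q
  no-ties y p∈ q∈ Δ≡ with ∈-anchors⁻ p∈ | ∈-anchors⁻ q∈
  ... | j , lj , refl | j′ , lj′ , refl = parity-gap (ones y) Q (inner (anchor j) y) (inner (anchor j′) y)
    (fromℤ-injective (trans (Eq.sym (relabel j lj)) (trans Δ≡ (relabel j′ lj′))))
    where
    relabel : ∀ j {b} → label j ≡ b → Δ y (point j) ≡ fromℤ (ones y ℤ.+ (bℤ b ℤ.+ Q) ℤ.- + 2 ℤ.* inner (anchor j) y)
    relabel j refl = Δ-point y j

  nearer : ∀ x j j′ → label j ≢ label j′ → value (V.lookup slots j′) x ℤ.< value (V.lookup slots j) x →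
    Δ (lift x) (point j) ℚ.< Δ (lift x) (point j′)
  nearer x j j′ l≢l′ v′<v = subst₂ ℚ._<_ (Eq.sym (Δ-point (lift x) j)) (Eq.sym (Δ-point (lift x) j′))
    (fromℤ-mono-< (larger-value-nearer (ones (lift x)) Q _ _ l≢l′
      (subst₂ ℤ._<_ (Eq.sym (inner-anchor-lift j′ x)) (Eq.sym (inner-anchor-lift j x)) v′<v)))

  classifier : Vec Bool dim → Bool
  classifier = nearestPositive (anchors true) (anchors false)

  nnRep-anchors : ∀ {j₀} → label j₀ ≡ false → NNRep (anchors true) (anchors false) classifier
  nnRep-anchors {j₀} negative = nnRep-nearestPositive (anchors true) (anchors false) (∈-anchors⁺ j₀ negative) no-ties

  classifier-lift : ∀ x j → (∀ j′ → label j′ ≢ label j → value (V.lookup slots j′) x ℤ.< value (V.lookup slots j) x) →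
    classifier (lift x) ≡ label j
  classifier-lift x j dominates = classify (label j) refl
    where
    beats-others : ∀ {b} → label j ≡ b → Beats (lift x) (point j) (anchors (not b))
    beats-others lj = All.tabulate λ q∈ → case ∈-anchors⁻ q∈ of λ where
      (j′ , lj′ , refl) → nearer x j j′ (λ l≡l′ → not-¬ lj (trans l≡l′ lj′))
                                        (dominates j′ (λ l′≡l → not-¬ lj (trans (Eq.sym l′≡l) lj′)))
    any? : Dec (Any (λ p → Beats (lift x) p (anchors false)) (anchors true))
    any? = Any.any? (λ p → beats? (lift x) p (anchors false)) (anchors true)
    classify : ∀ b → label j ≡ b → classifier (lift x) ≡ b
    classify true lj = dec-true any? (lose (∈-anchors⁺ j lj) (beats-others lj))
    classify false lj = dec-false any? λ found → case find found of λ where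
      (p , p∈ , p-beats) → ℚP.<-asym (All.lookup p-beats (∈-anchors⁺ j lj)) (All.lookup (beats-others lj) p∈)

module _ (f : ℕ → ℕ) (f-mono : ∀ {a b} → a ℕ.< b → f a ℕ.< f b) where

  private
    f-injective : ∀ {a b} → f a ≡ f b → a ≡ b
    f-injective {a} {b} fa≡fb with ℕP.<-cmp a b
    ... | tri< a<b _ _ = ⊥-elim (ℕP.<-irrefl fa≡fb (f-mono a<b))
    ... | tri≈ _ a≡b _ = a≡b
    ... | tri> _ _ b<a = ⊥-elim (ℕP.<-irrefl (Eq.sym fa≡fb) (f-mono b<a))

    n≤f : ∀ n → n ℕ.≤ f n
    n≤f zero = ℕ.z≤n
    n≤f (suc n) = ℕP.≤-<-trans (n≤f n) (f-mono (ℕP.n<1+n n))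

    search : ∀ m → ℕ → Maybe (∃[ n ] f n ≡ m)
    search m zero = nothing
    search m (suc c) with f c ℕ.≟ m
    ... | yes fc≡m = just (c , fc≡m)
    ... | no _ = search m c

    search-finds : ∀ n c → n ℕ.< c → search (f n) c ≡ just (n , refl)
    search-finds n (suc c) n<1+c with f c ℕ.≟ f n
    ... | yes fc≡fn with f-injective fc≡fn
    ...   | refl with fc≡fn
    ...     | refl = refl
    search-finds n (suc c) n<1+c | no fc≢fn with n ℕ.≟ c
    ...   | yes refl = ⊥-elim (fc≢fn refl)
    ...   | no n≢c = search-finds n c (ℕP.≤∧≢⇒< (ℕ.s≤s⁻¹ n<1+c) n≢c)

  preimage : ∀ m → Maybe (∃[ n ] f n ≡ m)
  preimage m = search m (suc m)

  preimage-f : ∀ n → preimage (f n) ≡ just (n , refl)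
  preimage-f n = search-finds n (suc (f n)) (ℕ.s≤s (n≤f n))

  module _ (g : (n : ℕ) → Vec Bool (f n) → Bool) where

    extendAt : ∀ m → Maybe (∃[ n ] f n ≡ m) → Vec Bool m → Bool
    extendAt _ (just (n , refl)) = g n
    extendAt _ nothing = λ _ → false

    extend : Family
    extend m = extendAt m (preimage m)

    extend-f : ∀ n y → extend (f n) y ≡ g n y
    extend-f n y rewrite preimage-f n = refl

    NN-extend : ∀ k → (∀ n → ∃[ P ] ∃[ N ] (length P ℕ.+ length N ℕ.≤ polyBound (suc k) (f n) × NNRep P N (g n))) →
      NN extend
    NN-extend k nn = suc k , λ m → nnAt m (preimage m)
      where
      nnAt : ∀ m s → ∃[ P ] ∃[ N ] (length P ℕ.+ length N ℕ.≤ polyBound (suc k) m × NNRep P N (extendAt m s))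
      nnAt _ (just (n , refl)) = nn n
      nnAt m nothing = [] , V.replicate m ℚ.0ℚ ∷ [] , polyBound-suc-positive k m ,
        (λ _ ()) , λ y → (λ ()) , λ _ → _ , here refl , []

closureNN-intro : ∀ F (f : ℕ → ℕ) (f-mono : ∀ {a b} → a ℕ.< b → f a ℕ.< f b) k → (∀ n → f n ℕ.≤ polyBound k n) →
  (g : (n : ℕ) → Vec Bool (f n) → Bool) → ∀ k′ →
  (∀ n → ∃[ P ] ∃[ N ] (length P ℕ.+ length N ℕ.≤ polyBound (suc k′) (f n) × NNRep P N (g n))) →
  (σ : (n : ℕ) → Substitution n (f n)) → (∀ n x → F n x ≡ g n (applySubst (σ n) x)) → closure NN F
closureNN-intro F f f-mono k f≤ g k′ nn σ F≡g∘σ = extend f f-mono g , NN-extend f f-mono g k′ nn , k ,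
  λ n → f n , f≤ n , σ n , λ x → trans (F≡g∘σ n x) (Eq.sym (extend-f f f-mono g n (applySubst (σ n) x)))

applySubst-++ : ∀ {n a b} (σ : Substitution n a) (τ : Substitution n b) x →
  applySubst (σ V.++ τ) x ≡ applySubst σ x V.++ applySubst τ x
applySubst-++ [] τ x = refl
applySubst-++ (s ∷ σ) τ x = cong (_ ∷_) (applySubst-++ σ τ x)

applySubst-constants : ∀ {n} c b (x : Vec Bool n) → applySubst (V.replicate c (inj₂ b)) x ≡ V.replicate c b
applySubst-constants zero b x = refl
applySubst-constants (suc c) b x = cong (b ∷_) (applySubst-constants c b x)

applySubst-variables : ∀ {n} (x : Vec Bool n) → applySubst (V.map inj₁ (V.allFin n)) x ≡ x
applySubst-variables {n} x = trans (Eq.sym (VP.map-∘ _ inj₁ (V.allFin n))) (VP.map-lookup-allFin x)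

pad : ∀ {A : Set} → A → List A → (N : ℕ) → Vec A N
pad d xs zero = []
pad d [] (suc N) = d ∷ pad d [] N
pad d (x ∷ xs) (suc N) = x ∷ pad d xs N

lookup-pad : ∀ {A : Set} (Q : A → Set) {d xs} N → Q d → All Q xs → ∀ j → Q (V.lookup (pad d xs N) j)
lookup-pad Q {xs = []} (suc N) qd [] zero = qd
lookup-pad Q {xs = []} (suc N) qd [] (suc j) = lookup-pad Q N qd [] j
lookup-pad Q {xs = x ∷ xs} (suc N) qd (qx ∷ qxs) zero = qx
lookup-pad Q {xs = x ∷ xs} (suc N) qd (qx ∷ qxs) (suc j) = lookup-pad Q N qd qxs j

∈⇒lookup-pad : ∀ {A : Set} {d x : A} {xs} N → x ∈ xs → length xs ℕ.≤ N → ∃[ j ] V.lookup (pad d xs N) j ≡ x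
∈⇒lookup-pad (suc N) (here refl) _ = zero , refl
∈⇒lookup-pad (suc N) (there x∈) (ℕ.s≤s len≤) with ∈⇒lookup-pad N x∈ len≤
... | j , lookup≡x = suc j , lookup≡x

anchorDim : ℕ → ℕ → ℕ
anchorDim k n = suc (suc (suc (polyBound k n)) ℕ.* suc n)

anchorDim-mono : ∀ k {a b} → a ℕ.< b → anchorDim k a ℕ.< anchorDim k b
anchorDim-mono k {a} {b} a<b = ℕ.s≤s (ℕP.<-≤-trans (ℕP.*-monoʳ-< (suc (suc (polyBound k a))) (ℕ.s≤s a<b))
                                               (ℕP.*-monoˡ-≤ (suc b) (ℕ.s≤s (ℕ.s≤s (polyBound-monoʳ k (ℕP.<⇒≤ a<b))))))

anchorDim≤polyBound : ∀ k n → anchorDim k n ℕ.≤ polyBound (3 ℕ.+ k) n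
anchorDim≤polyBound k n = begin
  suc ((2 ℕ.+ k ℕ.* X) ℕ.* suc n)   ≤⟨ ℕ.s≤s (ℕP.*-monoˡ-≤ (suc n) (m+n*a≤[m+n]*a 2 k 1≤X)) ⟩
  suc ((2 ℕ.+ k) ℕ.* X ℕ.* suc n)   ≡⟨ cong suc (trans (ℕP.*-assoc (2 ℕ.+ k) X (suc n)) (cong ((2 ℕ.+ k) ℕ.*_) (ℕP.*-comm X (suc n)))) ⟩
  1 ℕ.+ (2 ℕ.+ k) ℕ.* suc n ℕ.^ suc k ≤⟨ m+n*a≤[m+n]*a 1 (2 ℕ.+ k) (ℕP.m^n>0 (suc n) (suc k)) ⟩
  (3 ℕ.+ k) ℕ.* suc n ℕ.^ suc k      ≤⟨ ℕP.*-monoʳ-≤ (3 ℕ.+ k) (ℕP.^-monoʳ-≤ (suc n) (ℕP.m≤n+m (suc k) 2)) ⟩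
  polyBound (3 ℕ.+ k) n ∎
  where
  open ℕP.≤-Reasoning
  X : ℕ
  X = suc n ℕ.^ k
  1≤X : 1 ℕ.≤ X
  1≤X = ℕP.m^n>0 (suc n) k

LDL⊆closureNN : ∀ F → LDL F → closure NN F
LDL⊆closureNN F (k , ldl) = closureNN-intro F (anchorDim k) (anchorDim-mono k) (3 ℕ.+ k) (anchorDim≤polyBound k)
  (λ n → Anchors.classifier (slots n)) 0 nnAt liftSubst F≡classifier∘lift
  where
  L : (n : ℕ) → LDList n
  L n = proj₁ (ldl n)

  slots : (n : ℕ) → Vec (Form n) (suc (polyBound k n))
  slots n = pad zeroForm (forms (L n)) (suc (polyBound k n))

  forms-fit : ∀ n → length (forms (L n)) ℕ.≤ suc (polyBound k n)
  forms-fit n = subst (ℕ._≤ suc (polyBound k n)) (Eq.sym (length-forms (L n))) (ℕ.s≤s (proj₁ (proj₂ (ldl n))))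

  slot∈forms : ∀ n j → V.lookup (slots n) j ∈ forms (L n)
  slot∈forms n = lookup-pad (_∈ forms (L n)) _ (zeroForm∈forms (L n)) (All.tabulate (λ f∈ → f∈))

  nnAt : ∀ n → ∃[ P ] ∃[ N ] (length P ℕ.+ length N ℕ.≤ polyBound 1 (anchorDim k n) × NNRep P N (Anchors.classifier (slots n)))
  nnAt n = anchors true , anchors false , size , nnRep-anchors (cong proj₂ (proj₂ zero-slot))
    where
    open Anchors (slots n)
    zero-slot : ∃[ j ] V.lookup (slots n) j ≡ zeroForm
    zero-slot = ∈⇒lookup-pad {d = zeroForm} (suc (polyBound k n)) (zeroForm∈forms (L n)) (forms-fit n)
    size : length (anchors true) ℕ.+ length (anchors false) ℕ.≤ polyBound 1 (anchorDim k n)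
    size = subst (ℕ._≤ polyBound 1 (anchorDim k n)) (Eq.sym length-anchors)
      (ℕP.≤-trans (ℕP.≤-trans (ℕP.m≤m*n (suc (polyBound k n)) (suc n)) (ℕP.m≤n+m _ (suc n)))
                  (ℕP.≤-trans (ℕP.n≤1+n _) (n≤polyBound1 (anchorDim k n))))

  liftSubst : (n : ℕ) → Substitution n (anchorDim k n)
  liftSubst n = inj₂ false ∷ ((inj₂ true ∷ V.map inj₁ (V.allFin n)) V.++ V.replicate _ (inj₂ false))

  applySubst-lift : ∀ n x → applySubst (liftSubst n) x ≡ Anchors.lift (slots n) x
  applySubst-lift n x = cong (false ∷_) (trans (applySubst-++ (inj₂ true ∷ V.map inj₁ (V.allFin n)) _ x)
    (cong₂ V._++_ (cong (true ∷_) (applySubst-variables x)) (applySubst-constants _ false x)))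

  F≡classifier∘lift : ∀ n x → F n x ≡ Anchors.classifier (slots n) (applySubst (liftSubst n) x)
  F≡classifier∘lift n x with forms-winner (L n) x
  ... | winner f₀ f₀∈ f₀-label _ f₀-beats with ∈⇒lookup-pad {d = zeroForm} (suc (polyBound k n)) f₀∈ (forms-fit n)
  ...   | j , slot≡f₀ = begin
    F n x                               ≡⟨ Eq.sym (proj₂ (proj₂ (ldl n)) x) ⟩
    ldlEval (L n) x                     ≡⟨ Eq.sym f₀-label ⟩
    proj₂ f₀                            ≡⟨ cong proj₂ (Eq.sym slot≡f₀) ⟩
    label j                             ≡⟨ Eq.sym (classifier-lift x j dominates) ⟩
    classifier (lift x)                 ≡⟨ cong classifier (Eq.sym (applySubst-lift n x)) ⟩
    classifier (applySubst (liftSubst n) x) ∎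
    where
    open ≡-Reasoning
    open Anchors (slots n)
    dominates : ∀ j′ → label j′ ≢ label j → value (V.lookup (slots n) j′) x ℤ.< value (V.lookup (slots n) j) x
    dominates j′ differ = subst (λ f → value (V.lookup (slots n) j′) x ℤ.< value f x) (Eq.sym slot≡f₀)
      (f₀-beats (slot∈forms n j′) (λ same → differ (trans same (cong proj₂ (Eq.sym slot≡f₀)))))

LDLpoly⊆LDL : ∀ F → LDLpoly F → LDL F
LDLpoly⊆LDL F (k , ldl) = k , λ n → case ldl n of λ where
  (L , length≤ , _ , computes) → L , length≤ , computes

closure-mono : ∀ {C D : Class} → (∀ F → C F → D F) → ∀ F → closure C F → closure D F
closure-mono C⊆D F (G , CG , sub) = G , C⊆D G CG , sub

corollary3 : ¬ (LDLpoly ≐ LDL) → ¬ (closure HNN ≐ closure NN)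
corollary3 LDLpoly≉LDL closureHNN≐closureNN = LDLpoly≉LDL λ F → LDLpoly⊆LDL F , LDL⊆LDLpoly F
  where
  LDL⊆LDLpoly : ∀ F → LDL F → LDLpoly F
  LDL⊆LDLpoly F = closureLDLpoly⊆LDLpoly F
                ∘ closure-mono HNN⊆LDLpoly F
                ∘ proj₂ (closureHNN≐closureNN F)
                ∘ LDL⊆closureNN F
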